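{- Let $n$ be a positive integer with $\gcd(n,6)=1$ which is not prime, let $p$ be a prime factor of $n$ and let $\alpha=n/p$. Then for any integer $1\le v<n$ there exist integers $k,j$ such that $|1+k\alpha|_n,|1+j\alpha|_n\in U(n)$, $|v+k\alpha|_n<\frac n2$ and $|v+j\alpha|_n>\frac n2$. Moreover, if $\gcd(v,p)=1$, then there exists an integer $t$ such that $y=1+t\alpha$ satisfies $|y|_n\in U(n)$ and $|yv|_n<\frac n2$.
   Context: For $x\in\mathbb{Z}$, $|x|_n$ denotes the unique integer in $[1,n]$ congruent to $x$ modulo $n$. $U(n)=\{k\in\mathbb{N}: 1\le k\le n-1,\ \gcd(k,n)=1\}$ is the set of units modulo $n$; an integer is said to lie in $U(n)$ when its residue $|\cdot|_n$ does. -}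

module Defs where

open import Data.Nat using (ℕ; suc; _≤_; _<_; _∸_; NonZero)
open import Data.Nat.GCD using (gcd)
open import Data.Integer using (ℤ; _-_; _%ℕ_; +_)
open import Data.Product using (_×_)
open import Relation.Binary.PropositionalEquality using (_≡_)

-- |x|_n : the unique integer in [1,n] congruent to x modulo n,
-- computed as 1 + ((x - 1) mod n).
∣_∣[_] : ℤ → (n : ℕ) → .{{NonZero n}} → ℕ
∣ x ∣[ n ] = suc ((x - + 1) %ℕ n)

InU : ℕ → ℕ → Set
InU n k = (1 ≤ k) × (k ≤ n ∸ 1) × (gcd k n ≡ 1)

-- Idea: write n = α p and v = 1 + r + q α with r < α, q < p.  Adding multiples of α
-- only moves the "digit" q, so as k runs through consecutive integers, v + k α runs
-- through the residues 1 + r + i α (i < p) in order; i ∈ {0, 1} lands below n/2 and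
-- i ∈ {p - 2, p - 1} above it, because p ≥ 5.  Of two consecutive k at least one has
-- p ∤ 1 + k α, and then 1 + k α is a unit: its common divisors with n = α p are prime
-- to p, hence divide α, hence divide 1.  If w v ≡ 1 (mod p) then α v w ≡ α (mod n), so
-- y = 1 + w k α satisfies y v ≡ v + k α (mod n) and the same search applies to t = w k.
module Submission where

open import Defs
open import Data.Nat using (ℕ; suc; _+_; _*_; _∸_; _/_; _%_; _≤_; _<_; z≤n; s≤s; z<s; NonZero; ≢-nonZero; ≢-nonZero⁻¹)
open import Data.Nat.Properties
open import Data.Nat.DivMod using (m≡m%n+[m/n]*n; [m+n]%n≡m%n; [m+kn]%n≡m%n; m<n⇒m%n≡m; m%n<n)
open import Data.Nat.Divisibility using (_∣_; _∣?_; divides; ∣-refl; ∣-trans; ∣1⇒≡1; ∣m∣n⇒∣m+n; ∣m+n∣m⇒∣n; m∣m*n; n∣m*n; n∣m⇒m%n≡0)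
open import Data.Nat.GCD using (gcd; gcd-greatest; module Bézout)
open import Data.Nat.Coprimality using (Coprime; coprime⇒gcd≡1; gcd≡1⇒coprime; coprime-Bézout; coprime-divisor)
open import Data.Nat.Primality using (Prime; prime⇒irreducible; prime⇒nonZero; euclidsLemma; ¬prime[0]; ¬prime[1]; prime⇒¬composite; composite[4])
open import Data.Nat.Tactic.RingSolver using (solve-∀)
open import Data.Integer using (ℤ; +_; _%ℕ_) renaming (_+_ to _+ℤ_; _*_ to _*ℤ_)
import Data.Integer.Properties as ℤ
open import Data.Product using (_×_; _,_; ∃-syntax)
open import Data.Sum using (inj₁; inj₂)
open import Relation.Nullary using (¬_; yes; no; contradiction)
open import Relation.Binary.PropositionalEquality using (_≡_; refl; sym; trans; cong; subst; subst₂; module ≡-Reasoning)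

∣1+m∣≡1+m%n : ∀ m n .{{_ : NonZero n}} → ∣ + suc m ∣[ n ] ≡ suc (m % n)
∣1+m∣≡1+m%n m n = cong (λ x → suc (x %ℕ n)) (trans (ℤ.[1+m]⊖[1+n]≡m⊖n m 0) (ℤ.⊖-≥ z≤n))

+m+k*α≡+[m+k*α] : ∀ m k α → + m +ℤ + k *ℤ + α ≡ + (m + k * α)
+m+k*α≡+[m+k*α] m k α = cong (+ m +ℤ_) (sym (ℤ.pos-* k α))

[1+t*α]*v≡+[v+t*α*v] : ∀ t α v → (+ 1 +ℤ + t *ℤ + α) *ℤ + v ≡ + (v + t * α * v)
[1+t*α]*v≡+[v+t*α*v] t α v =
  trans (cong (_*ℤ + v) (+m+k*α≡+[m+k*α] 1 t α)) (sym (ℤ.pos-* (suc (t * α)) v))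

m+an≡o+bn⇒m%n≡o%n : ∀ {m o} a b n .{{_ : NonZero n}} → m + a * n ≡ o + b * n → m % n ≡ o % n
m+an≡o+bn⇒m%n≡o%n {m} {o} a b n eq = begin
  m % n           ≡⟨ sym ([m+kn]%n≡m%n m a n) ⟩
  (m + a * n) % n ≡⟨ cong (_% n) eq ⟩
  (o + b * n) % n ≡⟨ [m+kn]%n≡m%n o b n ⟩
  o % n           ∎
  where open ≡-Reasoning

∣1+n∣n⇒∣1 : ∀ {d m} → d ∣ suc m → d ∣ m → d ∣ 1
∣1+n∣n⇒∣1 {d} {m} d∣1+m d∣m = ∣m+n∣m⇒∣n (subst (d ∣_) (+-comm 1 m) d∣1+m) d∣m

prime∤1 : ∀ {p} → Prime p → ¬ p ∣ 1
prime∤1 p-prime p∣1 = ¬prime[1] (subst Prime (∣1⇒≡1 p∣1) p-prime)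

∤⇒coprime : ∀ {p m} → Prime p → ¬ p ∣ m → Coprime m p
∤⇒coprime p-prime p∤m {d} (d∣m , d∣p) with prime⇒irreducible p-prime d∣p
... | inj₁ d≡1 = d≡1
... | inj₂ refl = contradiction d∣m p∤m

coprime-+kn⇒coprime : ∀ {m n} k → Coprime (m + k * n) n → Coprime m n
coprime-+kn⇒coprime k cop (d∣m , d∣n) = cop (∣m∣n⇒∣m+n d∣m (∣-trans d∣n (n∣m*n k)) , d∣n)

coprime⇒InU : ∀ {m n} → 1 < n → 1 ≤ m → m ≤ n → Coprime m n → InU n m
coprime⇒InU {m} {n} 1<n 1≤m m≤n cop = 1≤m , pred-mono-≤ m<n , coprime⇒gcd≡1 cop
  where
  m<n : m < n
  m<n = ≤∧≢⇒< m≤n λ { refl → >⇒≢ 1<n (cop (∣-refl , ∣-refl)) }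

1+m%n∈U : ∀ m n .{{_ : NonZero n}} → 1 < n → Coprime (suc m) n → InU n (suc (m % n))
1+m%n∈U m n 1<n cop =
  coprime⇒InU 1<n (s≤s z≤n) (m%n<n m n) (coprime-+kn⇒coprime (m / n) cop′)
  where
  cop′ : Coprime (suc (m % n) + (m / n) * n) n
  cop′ = subst (λ x → Coprime x n) (cong suc (m≡m%n+[m/n]*n m n)) cop

-- w v ≡ 1 (mod p), stated without subtraction.
coprime⇒inverse : ∀ {v p} .{{_ : NonZero p}} → Coprime v p →
                  ∃[ w ] ∃[ c ] ∃[ E ] w * v + c * p ≡ 1 + E * p
coprime⇒inverse {v} {suc p′} cop with coprime-Bézout cop
... | Bézout.+- x y eq = x , 0 , y , trans (+-identityʳ (x * v)) (sym eq)
... | Bézout.-+ x y eq = p′ * x , 1 , p′ * y , (begin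
  p′ * x * v + 1 * suc p′ ≡⟨ expand p′ x v ⟩
  1 + p′ * (1 + x * v)    ≡⟨ cong (λ z → 1 + p′ * z) eq ⟩
  1 + p′ * (y * suc p′)   ≡⟨ reassociate p′ y ⟩
  1 + p′ * y * suc p′     ∎)
  where
  open ≡-Reasoning
  expand : ∀ p′ x v → p′ * x * v + 1 * suc p′ ≡ 1 + p′ * (1 + x * v)
  expand = solve-∀
  reassociate : ∀ p′ y → 1 + p′ * (y * suc p′) ≡ 1 + p′ * y * suc p′
  reassociate = solve-∀

module _ {p α : ℕ} (p-prime : Prime p) where

  ∤1+kα⇒coprime : ∀ {k} → ¬ p ∣ suc (k * α) → Coprime (suc (k * α)) (α * p)
  ∤1+kα⇒coprime {k} p∤ {d} (d∣ , d∣αp) = ∣1⇒≡1 (∣1+n∣n⇒∣1 d∣ (∣-trans d∣α (n∣m*n k)))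
    where
    d∣α : d ∣ α
    d∣α = coprime-divisor (∤⇒coprime p-prime λ p∣d → p∤ (∣-trans p∣d d∣))
                          (subst (d ∣_) (*-comm α p) d∣αp)

  ∣1+kα⇒∤1+[d+k]α : ∀ {k d} → ¬ p ∣ d → p ∣ suc (k * α) → ¬ p ∣ suc ((d + k) * α)
  ∣1+kα⇒∤1+[d+k]α {k} {d} p∤d p∣1+kα p∣1+[d+k]α with euclidsLemma d α p-prime p∣dα
    where
    p∣dα : p ∣ d * α
    p∣dα = ∣m+n∣m⇒∣n (subst (p ∣_) (cong suc (trans (*-distribʳ-+ α d k) (+-comm (d * α) (k * α))))
                               p∣1+[d+k]α) p∣1+kα
  ... | inj₁ p∣d = p∤d p∣d
  ... | inj₂ p∣α = prime∤1 p-prime (∣1+n∣n⇒∣1 p∣1+kα (∣-trans p∣α (n∣m*n k)))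

  choose-∤1+kα : (P : ℕ → Set) (k d : ℕ) → ¬ p ∣ d → P k → P (d + k) → ∃[ k′ ] ¬ p ∣ suc (k′ * α) × P k′
  choose-∤1+kα P k d p∤d Pk Pd+k with p ∣? suc (k * α)
  ... | no p∤1+kα = k , p∤1+kα , Pk
  ... | yes p∣1+kα = d + k , ∣1+kα⇒∤1+[d+k]α p∤d p∣1+kα , Pd+k

r+i*α<α*p : ∀ {r i α p} → r < α → i < p → r + i * α < α * p
r+i*α<α*p {r} {i} {α} {p} r<α i<p = begin-strict
  r + i * α <⟨ +-monoˡ-< (i * α) r<α ⟩
  suc i * α ≤⟨ *-monoˡ-≤ α i<p ⟩
  p * α     ≡⟨ *-comm p α ⟩
  α * p     ∎
  where open ≤-Reasoning

low-window : ∀ {r i α p} → r < α → i ≤ 1 → 5 ≤ p → 2 * suc (r + i * α) < α * p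
low-window {r} {i} {α} {p} r<α i≤1 5≤p = begin-strict
  2 * suc (r + i * α) ≤⟨ *-monoʳ-≤ 2 (+-mono-≤ r<α i*α≤α) ⟩
  2 * (α + α)         <⟨ m<m+n (2 * (α + α)) (≤-trans (s≤s z≤n) r<α) ⟩
  2 * (α + α) + α     ≡⟨ four-plus-one α ⟩
  α * 5               ≤⟨ *-monoʳ-≤ α 5≤p ⟩
  α * p               ∎
  where
  open ≤-Reasoning
  i*α≤α : i * α ≤ α
  i*α≤α = ≤-trans (*-monoˡ-≤ α i≤1) (≤-reflexive (*-identityˡ α))
  four-plus-one : ∀ α → 2 * (α + α) + α ≡ α * 5
  four-plus-one = solve-∀

high-window : ∀ {r i α p} → 2 ≤ i → p ≤ 2 + i → α * p < 2 * suc (r + i * α)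
high-window {r} {i} {α} {p} 2≤i p≤2+i = begin-strict
  α * p               ≤⟨ *-monoʳ-≤ α p≤2+i ⟩
  α * (2 + i)         ≡⟨ distrib α i ⟩
  2 * α + i * α       ≤⟨ +-monoˡ-≤ (i * α) (*-monoˡ-≤ α 2≤i) ⟩
  i * α + i * α       ≡⟨ double (i * α) ⟩
  2 * (i * α)         ≤⟨ *-monoʳ-≤ 2 (m≤n+m (i * α) r) ⟩
  2 * (r + i * α)     <⟨ *-monoʳ-< 2 (n<1+n (r + i * α)) ⟩
  2 * suc (r + i * α) ∎
  where
  open ≤-Reasoning
  distrib : ∀ α i → α * (2 + i) ≡ 2 * α + i * α
  distrib = solve-∀
  double : ∀ x → x + x ≡ 2 * x
  double = solve-∀

module _ {n α p : ℕ} .{{_ : NonZero n}} (p-prime : Prime p) (5≤p : 5 ≤ p) (n≡α*p : n ≡ α * p) where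

  private
    instance
      α-nonZero : NonZero α
      α-nonZero = ≢-nonZero λ α≡0 → ≢-nonZero⁻¹ n (trans n≡α*p (cong (_* p) α≡0))

    1<n : 1 < n
    1<n = subst (1 <_) (sym n≡α*p) (≤-trans (≤-trans (s≤s (s≤s z≤n)) 5≤p) (m≤n*m p α))

    ∣1+m+k*α∣ : ∀ m k → ∣ + suc m +ℤ + k *ℤ + α ∣[ n ] ≡ suc ((m + k * α) % n)
    ∣1+m+k*α∣ m k = trans (cong ∣_∣[ n ] (+m+k*α≡+[m+k*α] (suc m) k α)) (∣1+m∣≡1+m%n (m + k * α) n)

    ∣[1+t*α]*v∣ : ∀ t v′ → ∣ (+ 1 +ℤ + t *ℤ + α) *ℤ + suc v′ ∣[ n ] ≡ suc ((v′ + t * α * suc v′) % n)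
    ∣[1+t*α]*v∣ t v′ = trans (cong ∣_∣[ n ] ([1+t*α]*v≡+[v+t*α*v] t α (suc v′))) (∣1+m∣≡1+m%n _ n)

  1+kα∈U : ∀ k → ¬ p ∣ suc (k * α) → InU n ∣ + 1 +ℤ + k *ℤ + α ∣[ n ]
  1+kα∈U k p∤ = subst (InU n) (sym (∣1+m+k*α∣ 0 k)) (1+m%n∈U (k * α) n 1<n coprime)
    where
    coprime : Coprime (suc (k * α)) n
    coprime = subst (Coprime (suc (k * α))) (sym n≡α*p) (∤1+kα⇒coprime {α = α} p-prime {k = k} p∤)

  unit-witness : {P : ℤ → Set} → ∃[ k ] ¬ p ∣ suc (k * α) × P (+ k) →
                 ∃[ k ] InU n ∣ + 1 +ℤ k *ℤ + α ∣[ n ] × P k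
  unit-witness (k , p∤1+kα , Pk) = + k , 1+kα∈U k p∤1+kα , Pk

  [x+wkαv]%n≡[x+kα]%n : ∀ {w v c E} x k → w * v + c * p ≡ 1 + E * p →
                        (x + w * k * α * v) % n ≡ (x + k * α) % n
  [x+wkαv]%n≡[x+kα]%n {w} {v} {c} {E} x k inv = m+an≡o+bn⇒m%n≡o%n (c * k) (k * E) n (begin
    x + w * k * α * v + c * k * n        ≡⟨ cong (λ m → x + w * k * α * v + c * k * m) n≡α*p ⟩
    x + w * k * α * v + c * k * (α * p)  ≡⟨ factor x w k α v c p ⟩
    x + k * α * (w * v + c * p)          ≡⟨ cong (λ m → x + k * α * m) inv ⟩
    x + k * α * (1 + E * p)              ≡⟨ expand x k α E p ⟩
    x + k * α + k * E * (α * p)          ≡⟨ cong (λ m → x + k * α + k * E * m) n≡α*p ⟨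
    x + k * α + k * E * n                ∎)
    where
    open ≡-Reasoning
    factor : ∀ x w k α v c p → x + w * k * α * v + c * k * (α * p) ≡ x + k * α * (w * v + c * p)
    factor = solve-∀
    expand : ∀ x k α E p → x + k * α * (1 + E * p) ≡ x + k * α + k * E * (α * p)
    expand = solve-∀

  -- v′ = r + q α is the base-α expansion of v - 1, and s = p - q, so adding (i + s) α
  -- replaces the digit q by i modulo n.
  module Digits {v′ r q s : ℕ} (v′≡r+qα : v′ ≡ r + q * α) (r<α : r < α) (q+s≡p : q + s ≡ p) where

    shift : ∀ i → i < p → (v′ + (i + s) * α) % n ≡ r + i * α
    shift i i<p = begin
      (v′ + (i + s) * α) % n        ≡⟨ cong (λ m → (m + (i + s) * α) % n) v′≡r+qα ⟩
      (r + q * α + (i + s) * α) % n ≡⟨ cong (_% n) (regroup r q s i α) ⟩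
      (r + i * α + α * (q + s)) % n ≡⟨ cong (λ m → (r + i * α + α * m) % n) q+s≡p ⟩
      (r + i * α + α * p) % n       ≡⟨ cong (λ m → (r + i * α + m) % n) n≡α*p ⟨
      (r + i * α + n) % n           ≡⟨ [m+n]%n≡m%n (r + i * α) n ⟩
      (r + i * α) % n               ≡⟨ m<n⇒m%n≡m (subst (r + i * α <_) (sym n≡α*p) (r+i*α<α*p r<α i<p)) ⟩
      r + i * α                     ∎
      where
      open ≡-Reasoning
      regroup : ∀ r q s i α → r + q * α + (i + s) * α ≡ r + i * α + α * (q + s)
      regroup = solve-∀

    low-shift : ∀ i → i ≤ 1 → 2 * suc ((v′ + (i + s) * α) % n) < n
    low-shift i i≤1 = subst₂ (λ a b → 2 * suc a < b) (sym (shift i i<p)) (sym n≡α*p) (low-window r<α i≤1 5≤p)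
      where
      i<p : i < p
      i<p = ≤-<-trans i≤1 (≤-trans (s≤s (s≤s z≤n)) 5≤p)

    high-shift : ∀ i → i < p → p ≤ 2 + i → n < 2 * suc ((v′ + (i + s) * α) % n)
    high-shift i i<p p≤2+i = subst₂ (λ a b → a < 2 * suc b) (sym n≡α*p) (sym (shift i i<p))
                               (high-window 2≤i p≤2+i)
      where
      2≤i : 2 ≤ i
      2≤i = +-cancelˡ-≤ 2 2 i (≤-trans (n≤1+n 4) (≤-trans 5≤p p≤2+i))

    low-unit : ∃[ k ] InU n ∣ + 1 +ℤ k *ℤ + α ∣[ n ] × 2 * ∣ + suc v′ +ℤ k *ℤ + α ∣[ n ] < n
    low-unit = unit-witness (choose-∤1+kα {α = α} p-prime Low s 1 (prime∤1 p-prime) (low 0 z≤n) (low 1 ≤-refl))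
      where
      Low : ℕ → Set
      Low k = 2 * ∣ + suc v′ +ℤ + k *ℤ + α ∣[ n ] < n
      low : ∀ i → i ≤ 1 → Low (i + s)
      low i i≤1 = subst (λ x → 2 * x < n) (sym (∣1+m+k*α∣ v′ (i + s))) (low-shift i i≤1)

    high-unit : ∃[ j ] InU n ∣ + 1 +ℤ j *ℤ + α ∣[ n ] × n < 2 * ∣ + suc v′ +ℤ j *ℤ + α ∣[ n ]
    high-unit = unit-witness (choose-∤1+kα {α = α} p-prime High (h + s) 1 (prime∤1 p-prime)
      (high h (subst (h <_) 2+h≡p (m<n+m h z<s)) (≤-reflexive (sym 2+h≡p)))
      (high (suc h) (subst (suc h <_) 2+h≡p (n<1+n (suc h))) (≤-trans (≤-reflexive (sym 2+h≡p)) (n≤1+n _))))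
      where
      h : ℕ
      h = p ∸ 2
      2+h≡p : 2 + h ≡ p
      2+h≡p = m+[n∸m]≡n (≤-trans (s≤s (s≤s z≤n)) 5≤p)
      High : ℕ → Set
      High k = n < 2 * ∣ + suc v′ +ℤ + k *ℤ + α ∣[ n ]
      high : ∀ i → i < p → p ≤ 2 + i → High (i + s)
      high i i<p p≤2+i = subst (λ x → n < 2 * x) (sym (∣1+m+k*α∣ v′ (i + s))) (high-shift i i<p p≤2+i)

    scaled-low-unit : gcd (suc v′) p ≡ 1 →
      ∃[ t ] InU n ∣ + 1 +ℤ t *ℤ + α ∣[ n ] × 2 * ∣ (+ 1 +ℤ t *ℤ + α) *ℤ + suc v′ ∣[ n ] < n
    scaled-low-unit gcd≡1 with coprime⇒inverse {{prime⇒nonZero p-prime}} (gcd≡1⇒coprime gcd≡1)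
    ... | w , c , E , inv =
      unit-witness (choose-∤1+kα {α = α} p-prime Scaled (w * s) w p∤w
                                  (scaled 0 z≤n) (subst Scaled (*-suc w s) (scaled 1 ≤-refl)))
      where
      p∤w : ¬ p ∣ w
      p∤w p∣w = prime∤1 p-prime (∣1+n∣n⇒∣1 p∣1+Ep (n∣m*n E))
        where
        p∣1+Ep : p ∣ 1 + E * p
        p∣1+Ep = subst (p ∣_) inv (∣m∣n⇒∣m+n (∣-trans p∣w (m∣m*n (suc v′))) (n∣m*n c))
      Scaled : ℕ → Set
      Scaled t = 2 * ∣ (+ 1 +ℤ + t *ℤ + α) *ℤ + suc v′ ∣[ n ] < n
      scaled : ∀ i → i ≤ 1 → Scaled (w * (i + s))
      scaled i i≤1 = subst (λ x → 2 * x < n) (sym residue) (low-shift i i≤1)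
        where
        residue : ∣ (+ 1 +ℤ + (w * (i + s)) *ℤ + α) *ℤ + suc v′ ∣[ n ] ≡ suc ((v′ + (i + s) * α) % n)
        residue = trans (∣[1+t*α]*v∣ (w * (i + s)) v′)
                        (cong suc ([x+wkαv]%n≡[x+kα]%n {w} {suc v′} {c} {E} v′ (i + s) inv))

  digits : ∀ {v′} → v′ < n → ∃[ r ] ∃[ q ] ∃[ s ] v′ ≡ r + q * α × r < α × q + s ≡ p
  digits {v′} v′<n = v′ % α , q , p ∸ q , m≡m%n+[m/n]*n v′ α , m%n<n v′ α , m+[n∸m]≡n (<⇒≤ q<p)
    where
    q : ℕ
    q = v′ / α
    q<p : q < p
    q<p = *-cancelʳ-< α q p (begin-strict
      q * α          ≤⟨ m≤n+m (q * α) (v′ % α) ⟩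
      v′ % α + q * α ≡⟨ m≡m%n+[m/n]*n v′ α ⟨
      v′             <⟨ v′<n ⟩
      n              ≡⟨ trans n≡α*p (*-comm α p) ⟩
      p * α          ∎)
      where open ≤-Reasoning

coprime-6⇒prime-factor≥5 : ∀ {n p} → gcd n 6 ≡ 1 → Prime p → p ∣ n → 5 ≤ p
coprime-6⇒prime-factor≥5 {p = 0} _ p-prime _ = contradiction p-prime ¬prime[0]
coprime-6⇒prime-factor≥5 {p = 1} _ p-prime _ = contradiction p-prime ¬prime[1]
coprime-6⇒prime-factor≥5 {p = 2} gcd≡1 p-prime p∣n =
  contradiction (subst (2 ∣_) gcd≡1 (gcd-greatest p∣n (divides 3 refl))) (prime∤1 p-prime)
coprime-6⇒prime-factor≥5 {p = 3} gcd≡1 p-prime p∣n =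
  contradiction (subst (3 ∣_) gcd≡1 (gcd-greatest p∣n (divides 2 refl))) (prime∤1 p-prime)
coprime-6⇒prime-factor≥5 {p = 4} _ p-prime _ = contradiction composite[4] (prime⇒¬composite p-prime)
coprime-6⇒prime-factor≥5 {p = suc (suc (suc (suc (suc _))))} _ _ _ = s≤s (s≤s (s≤s (s≤s (s≤s z≤n))))

lemma2p2 : (n : ℕ) .{{_ : NonZero n}} → gcd n 6 ≡ 1 → ¬ Prime n →
    (p : ℕ) .{{_ : NonZero p}} → Prime p → p ∣ n →
    (v : ℕ) → 1 ≤ v → v < n →
    (∃[ k ] ∃[ j ]
        InU n ∣ + 1 +ℤ k *ℤ + (n / p) ∣[ n ]
      × InU n ∣ + 1 +ℤ j *ℤ + (n / p) ∣[ n ]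
      × 2 * ∣ + v +ℤ k *ℤ + (n / p) ∣[ n ] < n
      × n < 2 * ∣ + v +ℤ j *ℤ + (n / p) ∣[ n ])
    × (gcd v p ≡ 1 →
        ∃[ t ] InU n ∣ + 1 +ℤ t *ℤ + (n / p) ∣[ n ]
          × 2 * ∣ (+ 1 +ℤ t *ℤ + (n / p)) *ℤ + v ∣[ n ] < n)
lemma2p2 n gcd[n,6]≡1 _ p p-prime p∣n (suc v′) _ v<n =
  let r , q , s , v′≡r+qα , r<α , q+s≡p = digits {α = α} p-prime 5≤p n≡α*p (<-trans (n<1+n v′) v<n)
      open Digits {α = α} p-prime 5≤p n≡α*p {q = q} v′≡r+qα r<α q+s≡p
      k , k∈U , below-k = low-unit
      j , j∈U , above-j = high-unit
  in (k , j , k∈U , j∈U , below-k , above-j) , scaled-low-unit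
  where
  α : ℕ
  α = n / p
  5≤p : 5 ≤ p
  5≤p = coprime-6⇒prime-factor≥5 gcd[n,6]≡1 p-prime p∣n
  n≡α*p : n ≡ α * p
  n≡α*p = trans (m≡m%n+[m/n]*n n p) (cong (_+ α * p) (n∣m⇒m%n≡0 n p p∣n))
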